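{- Let $m\ge 2$ and $n\ge 0$. For a symbol $x\in\{0,1,\dots,m-1\}$ and $1\le i\le m-1$ define $x^{(i)}=0$ if $x<i$, $x^{(i)}=1$ if $x=i$, and $x^{(i)}=\lambda$ (the empty string) if $x>i$; for $x=x_1\dots x_n\in\{0,1,\dots,m-1\}^n$ let $x^{(i)}=x_1^{(i)}*\cdots*x_n^{(i)}$, where $*$ denotes concatenation. For nonnegative integers $n_0,\dots,n_{m-1}$ with $n_0+\cdots+n_{m-1}=n$, let $S=S_{(n_0,n_1,\dots,n_{m-1})}$, and for a set $T$ of strings let $T^{(i)}=\{x^{(i)}\mid x\in T\}$. Then for each $i$, \[ S^{(i)}=S_{(n_0+\cdots+n_{i-1},\,n_i)}, \] and the mapping $\Phi\colon x\mapsto (x^{(1)},\dots,x^{(m-1)})$ is a one-to-one correspondence between $S$ and $S^{(1)}\times\cdots\times S^{(m-1)}$.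
   Context: For an alphabet $\{0,1,\dots,k-1\}$ and nonnegative integers $n_0,\dots,n_{k-1}$, $S_{(n_0,\dots,n_{k-1})}$ denotes the set of all strings over $\{0,\dots,k-1\}$ of length $n_0+\cdots+n_{k-1}$ containing exactly $n_j$ occurrences of the symbol $j$ for each $j$. In particular, $S_{(l,k)}$ is the set of binary strings with $l$ zeros and $k$ ones. -}

module Defs where

open import Data.Nat using (ℕ; zero; suc; _<_; _<?_)
open import Data.Nat.Properties using (<-cmp)
open import Data.Fin using (Fin; toℕ; _≟_)
open import Data.List using (List; []; _∷_; _++_; length; filter; map; allFin; concatMap)
open import Data.Nat.ListAction using (sum)
open import Data.Product using (∃; _×_)
open import Relation.Binary.PropositionalEquality using (_≡_)
open import Relation.Binary.Definitions using (tri<; tri≈; tri>)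

count : {k : ℕ} → Fin k → List (Fin k) → ℕ
count j xs = length (filter (λ y → y ≟ j) xs)

InS : (k : ℕ) → (Fin k → ℕ) → List (Fin k) → Set
InS k ns xs = (j : Fin k) → count j xs ≡ ns j

-- the count vector (l , k') for binary strings: S_(l,k') = InS 2 (pair l k')
pair : ℕ → ℕ → Fin 2 → ℕ
pair l k' Fin.zero = l
pair l k' (Fin.suc Fin.zero) = k'

symProj : {m : ℕ} → ℕ → Fin m → List (Fin 2)
symProj i x with <-cmp (toℕ x) i
... | tri< _ _ _ = Fin.zero ∷ []
... | tri≈ _ _ _ = Fin.suc Fin.zero ∷ []
... | tri> _ _ _ = []

proj : {m : ℕ} → ℕ → List (Fin m) → List (Fin 2)
proj i xs = concatMap (symProj i) xs

prefixSum : {m : ℕ} → (Fin m → ℕ) → ℕ → ℕ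
prefixSum {m} ns i = sum (map ns (filter (λ j → toℕ j <? i) (allFin m)))

total : {m : ℕ} → (Fin m → ℕ) → ℕ
total {m} ns = sum (map ns (allFin m))

InImage : (m : ℕ) → (Fin m → ℕ) → ℕ → List (Fin 2) → Set
InImage m ns i y = ∃ λ x → InS m ns x × proj i x ≡ y

-- Counting: the 0s of x^(i) are the symbols of x below i and its 1s the
-- occurrences of i, so x ∈ S gives x^(i) ∈ S_(n_0+⋯+n_{i-1}, n_i).
-- Rearranging: conversely, cut x into its symbols below i, equal to i and
-- above i, interleave the first two blocks as the 0s and 1s of a prescribed
-- y ∈ S_(n_0+⋯+n_{i-1}, n_i), and append the third block.  The result is
-- a permutation of x (hence still in S) with i-th projection y and the same
-- projections at every lower level.  Starting from one explicit element of
-- S this shows that S^(i) is all of S_(n_0+⋯+n_{i-1}, n_i); fixing the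
-- levels 1,2,…,m-1 one after the other shows that Φ is surjective.
-- Injectivity: two strings are told apart by their projections at the
-- level of the larger of their first differing symbols (or, if one is a
-- proper prefix of the other, at the top level m-1).
module Submission where

open import Defs
open import Data.Nat using (ℕ; zero; suc; _≤_; _<_; _+_; s≤s; _<?_)
open import Data.Nat.Properties
  using (<-cmp; +-identityʳ; +-commutativeSemigroup; ≤⇒≯; <-trans; <⇒≤; ≤-refl; m<1+n⇒m≤n; m<1+n⇒m<n∨m≡n; suc-injective)
open import Algebra.Properties.CommutativeSemigroup +-commutativeSemigroup using (interchange)
open import Data.Fin using (Fin; toℕ; _≟_; fromℕ; fromℕ<)
open import Data.Fin.Properties using (toℕ-injective; toℕ-fromℕ<; toℕ-fromℕ; toℕ<n; 0≢1+n)
open import Data.List using (List; []; _∷_; _++_; length; filter; map; allFin; replicate)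
open import Data.List.Properties
  using (++-identityʳ; ++-assoc; ++-cancelˡ; ∷-injectiveˡ; map-cong; map-tabulate; filter-++; filter-accept; filter-reject; length-++; concatMap-++)
open import Data.List.Relation.Unary.All as All using (All; []; _∷_)
open import Data.List.Relation.Binary.Permutation.Propositional using (_↭_; ↭-refl; ↭-prep; ↭-sym; ↭-trans; ↭-reflexive)
open import Data.List.Relation.Binary.Permutation.Propositional.Properties using (↭-length; filter-↭; shift; ++⁺ʳ)
open import Data.Nat.ListAction using (sum)
open import Data.Vec using (Vec; tabulate; lookup)
open import Data.Vec.Properties using (lookup∘tabulate; tabulate-cong; tabulate∘lookup)
open import Data.Product using (∃; _×_; _,_)
open import Data.Sum using (inj₁; inj₂)
open import Data.Bool using (true; false; if_then_else_)
open import Function using (id)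
open import Function.Bundles using (_⇔_; mk⇔)
open import Relation.Binary.PropositionalEquality using (_≡_; _≢_; refl; sym; trans; cong; cong₂; subst; module ≡-Reasoning)
open import Relation.Binary.Definitions using (tri<; tri≈; tri>)
open import Relation.Nullary using (yes; no; does; contradiction)
open import Relation.Unary using (Decidable)

open ≡-Reasoning

pattern one = Fin.suc Fin.zero

symProj-below : ∀ {m} i (a : Fin m) → toℕ a < i → symProj i a ≡ Fin.zero ∷ []
symProj-below i a a<i with <-cmp (toℕ a) i
... | tri< _ _ _ = refl
... | tri≈ a≮i _ _ = contradiction a<i a≮i
... | tri> a≮i _ _ = contradiction a<i a≮i

symProj-at : ∀ {m} i (a : Fin m) → toℕ a ≡ i → symProj i a ≡ one ∷ []
symProj-at i a a≡i with <-cmp (toℕ a) i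
... | tri< _ a≢i _ = contradiction a≡i a≢i
... | tri≈ _ _ _ = refl
... | tri> _ a≢i _ = contradiction a≡i a≢i

symProj-above : ∀ {m} i (a : Fin m) → i < toℕ a → symProj i a ≡ []
symProj-above i a i<a with <-cmp (toℕ a) i
... | tri< _ _ i≮a = contradiction i<a i≮a
... | tri≈ _ _ i≮a = contradiction i<a i≮a
... | tri> _ _ _ = refl

proj-above : ∀ {m} j (h : List (Fin m)) → All (λ a → j < toℕ a) h → proj j h ≡ []
proj-above j [] [] = refl
proj-above j (a ∷ h) (j<a ∷ j<h) = cong₂ _++_ (symProj-above j a j<a) (proj-above j h j<h)

count-++ : ∀ {m} (j : Fin m) xs ys → count j (xs ++ ys) ≡ count j xs + count j ys
count-++ j xs ys = trans (cong length (filter-++ (λ y → y ≟ j) xs ys)) (length-++ (filter (λ y → y ≟ j) xs))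

InS-↭ : ∀ {m} {ns : Fin m → ℕ} {xs ys} → xs ↭ ys → InS m ns ys → InS m ns xs
InS-↭ xs↭ys ysS j = trans (↭-length (filter-↭ (λ y → y ≟ j) xs↭ys)) (ysS j)

count-zero-map-suc : ∀ {m} (c : List (Fin m)) → count Fin.zero (map Fin.suc c) ≡ 0
count-zero-map-suc [] = refl
count-zero-map-suc (_ ∷ c) = count-zero-map-suc c

count-suc-map-suc : ∀ {m} (j : Fin m) (c : List (Fin m)) → count (Fin.suc j) (map Fin.suc c) ≡ count j c
count-suc-map-suc j [] = refl
count-suc-map-suc j (a ∷ c) with a ≟ j
... | yes _ = cong suc (count-suc-map-suc j c)
... | no _ = count-suc-map-suc j c

indicator : ∀ {m} {P : Fin m → Set} → Decidable P → Fin m → ℕ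
indicator P? a = if does (P? a) then 1 else 0

length-filter-∷ : ∀ {m} {P : Fin m → Set} (P? : Decidable P) a x →
  length (filter P? (a ∷ x)) ≡ indicator P? a + length (filter P? x)
length-filter-∷ P? a x with does (P? a)
... | true = refl
... | false = refl

sum-zeros : ∀ {A : Set} (L : List A) → sum (map (λ _ → 0) L) ≡ 0
sum-zeros [] = refl
sum-zeros (_ ∷ L) = sum-zeros L

sum-map-+ : ∀ {A : Set} (f g : A → ℕ) L → sum (map (λ j → f j + g j) L) ≡ sum (map f L) + sum (map g L)
sum-map-+ f g [] = refl
sum-map-+ f g (a ∷ L) = trans (cong (f a + g a +_) (sum-map-+ f g L)) (interchange (f a) (g a) _ _)

sum-indicator : ∀ {m} (a : Fin m) L → sum (map (λ j → count j (a ∷ [])) L) ≡ count a L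
sum-indicator a [] = refl
sum-indicator a (j ∷ L) with a ≟ j | j ≟ a
... | yes _ | yes _ = cong suc (sum-indicator a L)
... | yes a≡j | no j≢a = contradiction (sym a≡j) j≢a
... | no a≢j | yes j≡a = contradiction (sym j≡a) a≢j
... | no _ | no _ = sum-indicator a L

allFin-suc : ∀ m → allFin (suc m) ≡ Fin.zero ∷ map Fin.suc (allFin m)
allFin-suc m = cong (Fin.zero ∷_) (sym (map-tabulate id Fin.suc))

filter-map-suc : ∀ {m} {P : Fin (suc m) → Set} (P? : Decidable P) (L : List (Fin m)) →
  filter P? (map Fin.suc L) ≡ map Fin.suc (filter (λ j → P? (Fin.suc j)) L)
filter-map-suc P? [] = refl
filter-map-suc P? (a ∷ L) with does (P? (Fin.suc a))
... | true = cong (Fin.suc a ∷_) (filter-map-suc P? L)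
... | false = filter-map-suc P? L

-- Every symbol occurs exactly once in allFin m, so it occurs [P a] times in
-- the symbols satisfying P.
count-class-member : ∀ {m} {P : Fin m → Set} (P? : Decidable P) (a : Fin m) →
  count a (filter P? (allFin m)) ≡ indicator P? a
count-class-member {suc m} P? a = trans (cong (λ L → count a (filter P? L)) (allFin-suc m)) (by-head a)
  where
  T : List (Fin m)
  T = filter (λ j → P? (Fin.suc j)) (allFin m)
  shifted : ∀ a → count a (filter P? (map Fin.suc (allFin m))) ≡ count a (map Fin.suc T)
  shifted a = cong (count a) (filter-map-suc P? (allFin m))
  zero-in-tail : count Fin.zero (filter P? (map Fin.suc (allFin m))) ≡ 0
  zero-in-tail = trans (shifted Fin.zero) (count-zero-map-suc T)
  suc-in-tail : ∀ a → count (Fin.suc a) (filter P? (map Fin.suc (allFin m))) ≡ indicator P? (Fin.suc a)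
  suc-in-tail a = trans (shifted (Fin.suc a)) (trans (count-suc-map-suc a T) (count-class-member (λ j → P? (Fin.suc j)) a))
  by-head : ∀ a → count a (filter P? (Fin.zero ∷ map Fin.suc (allFin m))) ≡ indicator P? a
  by-head Fin.zero with does (P? Fin.zero)
  ... | true = cong suc zero-in-tail
  ... | false = zero-in-tail
  by-head (Fin.suc a) with does (P? Fin.zero)
  ... | true = suc-in-tail a
  ... | false = suc-in-tail a

count-class : ∀ {m} {P : Fin m → Set} (P? : Decidable P) (x : List (Fin m)) →
  length (filter P? x) ≡ sum (map (λ j → count j x) (filter P? (allFin m)))
count-class {m} P? [] = sym (sum-zeros (filter P? (allFin m)))
count-class {m} P? (a ∷ x) = begin
  length (filter P? (a ∷ x))
    ≡⟨ length-filter-∷ P? a x ⟩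
  indicator P? a + length (filter P? x)
    ≡⟨ cong₂ _+_ (sym (trans (sum-indicator a F) (count-class-member P? a))) (count-class P? x) ⟩
  sum (map (λ j → count j (a ∷ [])) F) + sum (map (λ j → count j x) F)
    ≡⟨ sym (sum-map-+ (λ j → count j (a ∷ [])) (λ j → count j x) F) ⟩
  sum (map (λ j → count j (a ∷ []) + count j x) F)
    ≡⟨ cong sum (map-cong (λ j → sym (count-++ j (a ∷ []) x)) F) ⟩
  sum (map (λ j → count j (a ∷ x)) F) ∎
  where
  F : List (Fin m)
  F = filter P? (allFin m)

canonical : ∀ {m} → (Fin m → ℕ) → List (Fin m)
canonical {zero} ns = []
canonical {suc m} ns = replicate (ns Fin.zero) Fin.zero ++ map Fin.suc (canonical (λ j → ns (Fin.suc j)))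

count-replicate : ∀ {m} (a : Fin m) n → count a (replicate n a) ≡ n
count-replicate a zero = refl
count-replicate a (suc n) with a ≟ a
... | yes _ = cong suc (count-replicate a n)
... | no a≢a = contradiction refl a≢a

count-suc-replicate-zero : ∀ {m} (j : Fin m) n → count (Fin.suc j) (replicate n Fin.zero) ≡ 0
count-suc-replicate-zero j zero = refl
count-suc-replicate-zero j (suc n) = count-suc-replicate-zero j n

canonical-InS : ∀ {m} (ns : Fin m → ℕ) → InS m ns (canonical ns)
canonical-InS {suc m} ns j = trans (count-++ j zeros (map Fin.suc rest)) (by-block j)
  where
  zeros : List (Fin (suc m))
  zeros = replicate (ns Fin.zero) Fin.zero
  rest : List (Fin m)
  rest = canonical (λ j → ns (Fin.suc j))
  by-block : ∀ j → count j zeros + count j (map Fin.suc rest) ≡ ns j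
  by-block Fin.zero = trans (cong₂ _+_ (count-replicate Fin.zero (ns Fin.zero)) (count-zero-map-suc rest))
                            (+-identityʳ (ns Fin.zero))
  by-block (Fin.suc j) = trans (cong₂ _+_ (count-suc-replicate-zero j (ns Fin.zero)) (count-suc-map-suc j rest))
                               (canonical-InS (λ j → ns (Fin.suc j)) j)

below level above : ∀ {m} → ℕ → List (Fin m) → List (Fin m)
below i [] = []
below i (a ∷ x) with <-cmp (toℕ a) i
... | tri< _ _ _ = a ∷ below i x
... | tri≈ _ _ _ = below i x
... | tri> _ _ _ = below i x
level i [] = []
level i (a ∷ x) with <-cmp (toℕ a) i
... | tri< _ _ _ = level i x
... | tri≈ _ _ _ = a ∷ level i x
... | tri> _ _ _ = level i x
above i [] = []
above i (a ∷ x) with <-cmp (toℕ a) i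
... | tri< _ _ _ = above i x
... | tri≈ _ _ _ = above i x
... | tri> _ _ _ = a ∷ above i x

all-below : ∀ {m} i (x : List (Fin m)) → All (λ a → toℕ a < i) (below i x)
all-below i [] = []
all-below i (a ∷ x) with <-cmp (toℕ a) i
... | tri< a<i _ _ = a<i ∷ all-below i x
... | tri≈ _ _ _ = all-below i x
... | tri> _ _ _ = all-below i x

all-level : ∀ {m} i (x : List (Fin m)) → All (λ a → toℕ a ≡ i) (level i x)
all-level i [] = []
all-level i (a ∷ x) with <-cmp (toℕ a) i
... | tri< _ _ _ = all-level i x
... | tri≈ _ a≡i _ = a≡i ∷ all-level i x
... | tri> _ _ _ = all-level i x

all-above : ∀ {m} i (x : List (Fin m)) → All (λ a → i < toℕ a) (above i x)
all-above i [] = []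
all-above i (a ∷ x) with <-cmp (toℕ a) i
... | tri< _ _ _ = all-above i x
... | tri≈ _ _ _ = all-above i x
... | tri> _ _ i<a = i<a ∷ all-above i x

split-↭ : ∀ {m} i (x : List (Fin m)) → below i x ++ level i x ++ above i x ↭ x
split-↭ i [] = ↭-refl
split-↭ i (a ∷ x) with <-cmp (toℕ a) i
... | tri< _ _ _ = ↭-prep a (split-↭ i x)
... | tri≈ _ _ _ = ↭-trans (shift a (below i x) (level i x ++ above i x)) (↭-prep a (split-↭ i x))
... | tri> _ _ _ = ↭-trans (↭-reflexive (sym (++-assoc (below i x) (level i x) (a ∷ above i x))))
    (↭-trans (shift a (below i x ++ level i x) (above i x))
      (↭-prep a (↭-trans (↭-reflexive (++-assoc (below i x) (level i x) (above i x))) (split-↭ i x))))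

count-zero-proj : ∀ {m} i (x : List (Fin m)) → count Fin.zero (proj i x) ≡ length (below i x)
count-zero-proj i [] = refl
count-zero-proj i (a ∷ x) with <-cmp (toℕ a) i
... | tri< _ _ _ = cong suc (count-zero-proj i x)
... | tri≈ _ _ _ = count-zero-proj i x
... | tri> _ _ _ = count-zero-proj i x

count-one-proj : ∀ {m} i (x : List (Fin m)) → count one (proj i x) ≡ length (level i x)
count-one-proj i [] = refl
count-one-proj i (a ∷ x) with <-cmp (toℕ a) i
... | tri< _ _ _ = count-one-proj i x
... | tri≈ _ _ _ = cong suc (count-one-proj i x)
... | tri> _ _ _ = count-one-proj i x

length-below : ∀ {m} i (x : List (Fin m)) → length (below i x) ≡ length (filter (λ a → toℕ a <? i) x)
length-below i [] = refl
length-below i (a ∷ x) with <-cmp (toℕ a) i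
... | tri< a<i _ _ = trans (cong suc (length-below i x)) (cong length (sym (filter-accept (λ b → toℕ b <? i) a<i)))
... | tri≈ a≮i _ _ = trans (length-below i x) (cong length (sym (filter-reject (λ b → toℕ b <? i) a≮i)))
... | tri> a≮i _ _ = trans (length-below i x) (cong length (sym (filter-reject (λ b → toℕ b <? i) a≮i)))

length-level : ∀ {m} (b : Fin m) (x : List (Fin m)) → length (level (toℕ b) x) ≡ count b x
length-level b [] = refl
length-level b (a ∷ x) with <-cmp (toℕ a) (toℕ b) | a ≟ b
... | tri< _ a≢b _ | yes a≡b = contradiction (cong toℕ a≡b) a≢b
... | tri< _ _ _ | no _ = length-level b x
... | tri≈ _ _ _ | yes _ = cong suc (length-level b x)
... | tri≈ _ a≡b _ | no a≢b = contradiction (toℕ-injective a≡b) a≢b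
... | tri> _ a≢b _ | yes a≡b = contradiction (cong toℕ a≡b) a≢b
... | tri> _ _ _ | no _ = length-level b x

proj-lower : ∀ {m} j i (x : List (Fin m)) → j < i → proj j x ≡ proj j (below i x)
proj-lower j i [] j<i = refl
proj-lower j i (a ∷ x) j<i with <-cmp (toℕ a) i
... | tri< _ _ _ = cong (symProj j a ++_) (proj-lower j i x j<i)
... | tri≈ _ a≡i _ = cong₂ _++_ (symProj-above j a (subst (j <_) (sym a≡i) j<i)) (proj-lower j i x j<i)
... | tri> _ _ i<a = cong₂ _++_ (symProj-above j a (<-trans j<i i<a)) (proj-lower j i x j<i)

interleave : ∀ {m} → List (Fin 2) → List (Fin m) → List (Fin m) → List (Fin m)
interleave [] l e = []
interleave (Fin.zero ∷ y) [] e = []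
interleave (Fin.zero ∷ y) (a ∷ l) e = a ∷ interleave y l e
interleave (one ∷ y) l [] = []
interleave (one ∷ y) l (b ∷ e) = b ∷ interleave y l e

interleave-↭ : ∀ {m} y (l e : List (Fin m)) → count Fin.zero y ≡ length l → count one y ≡ length e →
  interleave y l e ↭ l ++ e
interleave-↭ [] [] [] _ _ = ↭-refl
interleave-↭ (Fin.zero ∷ y) (a ∷ l) e #0 #1 = ↭-prep a (interleave-↭ y l e (suc-injective #0) #1)
interleave-↭ (one ∷ y) l (b ∷ e) #0 #1 =
  ↭-trans (↭-prep b (interleave-↭ y l e #0 (suc-injective #1))) (↭-sym (shift b l e))

proj-interleave : ∀ {m} i y (l e : List (Fin m)) → All (λ a → toℕ a < i) l → All (λ a → toℕ a ≡ i) e →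
  count Fin.zero y ≡ length l → count one y ≡ length e → proj i (interleave y l e) ≡ y
proj-interleave i [] [] [] _ _ _ _ = refl
proj-interleave i (Fin.zero ∷ y) (a ∷ l) e (a<i ∷ l<i) e≡i #0 #1 =
  cong₂ _++_ (symProj-below i a a<i) (proj-interleave i y l e l<i e≡i (suc-injective #0) #1)
proj-interleave i (one ∷ y) l (b ∷ e) l<i (b≡i ∷ e≡i) #0 #1 =
  cong₂ _++_ (symProj-at i b b≡i) (proj-interleave i y l e l<i e≡i #0 (suc-injective #1))

proj-interleave-lower : ∀ {m} j y (l e : List (Fin m)) → All (λ a → j < toℕ a) e →
  count Fin.zero y ≡ length l → count one y ≡ length e → proj j (interleave y l e) ≡ proj j l
proj-interleave-lower j [] [] [] _ _ _ = refl
proj-interleave-lower j (Fin.zero ∷ y) (a ∷ l) e j<e #0 #1 =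
  cong (symProj j a ++_) (proj-interleave-lower j y l e j<e (suc-injective #0) #1)
proj-interleave-lower j (one ∷ y) l (b ∷ e) (j<b ∷ j<e) #0 #1 =
  cong₂ _++_ (symProj-above j b j<b) (proj-interleave-lower j y l e j<e #0 (suc-injective #1))

rearrange : ∀ {m} i (x : List (Fin m)) y →
  count Fin.zero y ≡ length (below i x) → count one y ≡ length (level i x) →
  ∃ λ x′ → x′ ↭ x × proj i x′ ≡ y × (∀ j → j < i → proj j x′ ≡ proj j x)
rearrange {m} i x y #0 #1 = interleave y l e ++ h , permutation , projection-at-i , projection-below-i
  where
  l e h : List (Fin m)
  l = below i x
  e = level i x
  h = above i x
  permutation : interleave y l e ++ h ↭ x
  permutation = ↭-trans (++⁺ʳ h (interleave-↭ y l e #0 #1))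
    (↭-trans (↭-reflexive (++-assoc l e h)) (split-↭ i x))
  projection-at-i : proj i (interleave y l e ++ h) ≡ y
  projection-at-i = begin
    proj i (interleave y l e ++ h)       ≡⟨ concatMap-++ (symProj i) (interleave y l e) h ⟩
    proj i (interleave y l e) ++ proj i h ≡⟨ cong₂ _++_ (proj-interleave i y l e (all-below i x) (all-level i x) #0 #1)
                                                          (proj-above i h (all-above i x)) ⟩
    y ++ []                               ≡⟨ ++-identityʳ y ⟩
    y ∎
  projection-below-i : ∀ j → j < i → proj j (interleave y l e ++ h) ≡ proj j x
  projection-below-i j j<i = begin
    proj j (interleave y l e ++ h)        ≡⟨ concatMap-++ (symProj j) (interleave y l e) h ⟩
    proj j (interleave y l e) ++ proj j h ≡⟨ cong₂ _++_
        (proj-interleave-lower j y l e (All.map (λ a≡i → subst (j <_) (sym a≡i) j<i) (all-level i x)) #0 #1)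
        (proj-above j h (All.map (<-trans j<i) (all-above i x))) ⟩
    proj j l ++ []                        ≡⟨ ++-identityʳ (proj j l) ⟩
    proj j l                              ≡⟨ proj-lower j i x j<i ⟨
    proj j x ∎

length-below-InS : ∀ {m} (ns : Fin m → ℕ) i x → InS m ns x → length (below i x) ≡ prefixSum ns i
length-below-InS {m} ns i x xS = begin
  length (below i x)                                                ≡⟨ length-below i x ⟩
  length (filter (λ j → toℕ j <? i) x)                              ≡⟨ count-class (λ j → toℕ j <? i) x ⟩
  sum (map (λ j → count j x) (filter (λ j → toℕ j <? i) (allFin m))) ≡⟨ cong sum (map-cong xS (filter (λ j → toℕ j <? i) (allFin m))) ⟩
  prefixSum ns i ∎

proj-InS : ∀ {m} (ns : Fin m → ℕ) (a : Fin m) x → InS m ns x →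
  InS 2 (pair (prefixSum ns (toℕ a)) (ns a)) (proj (toℕ a) x)
proj-InS ns a x xS Fin.zero = trans (count-zero-proj (toℕ a) x) (length-below-InS ns (toℕ a) x xS)
proj-InS ns a x xS one = trans (count-one-proj (toℕ a) x) (trans (length-level a x) (xS a))

image⊆S : ∀ {m} (ns : Fin m → ℕ) (a : Fin m) y → InImage m ns (toℕ a) y →
  InS 2 (pair (prefixSum ns (toℕ a)) (ns a)) y
image⊆S ns a _ (x , xS , refl) = proj-InS ns a x xS

adjust : ∀ {m} (ns : Fin m → ℕ) (a : Fin m) x y → InS m ns x → InS 2 (pair (prefixSum ns (toℕ a)) (ns a)) y →
  ∃ λ x′ → InS m ns x′ × proj (toℕ a) x′ ≡ y × (∀ j → j < toℕ a → proj j x′ ≡ proj j x)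
adjust ns a x y xS yS =
  let x′ , x′↭x , at-a , lower = rearrange (toℕ a) x y
        (trans (yS Fin.zero) (sym (length-below-InS ns (toℕ a) x xS)))
        (trans (yS one) (sym (trans (length-level a x) (xS a))))
  in x′ , InS-↭ x′↭x xS , at-a , lower

image-characterization : ∀ {m} (ns : Fin m → ℕ) (a : Fin m) y →
  InImage m ns (toℕ a) y ⇔ InS 2 (pair (prefixSum ns (toℕ a)) (ns a)) y
image-characterization ns a y = mk⇔ (image⊆S ns a y) S⊆image
  where
  S⊆image : InS 2 (pair (prefixSum ns (toℕ a)) (ns a)) y → InImage _ ns (toℕ a) y
  S⊆image yS = let x , xS , at-a , _ = adjust ns a (canonical ns) y (canonical-InS ns) yS
               in x , xS , at-a

tabulate-injective : ∀ {A : Set} {n} {f g : Fin n → A} → tabulate f ≡ tabulate g → ∀ i → f i ≡ g i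
tabulate-injective {f = f} {g} eq i = begin
  f i                   ≡⟨ lookup∘tabulate f i ⟨
  lookup (tabulate f) i ≡⟨ cong (λ v → lookup v i) eq ⟩
  lookup (tabulate g) i ≡⟨ lookup∘tabulate g i ⟩
  g i ∎

proj-∷-nonempty : ∀ {m} i (b : Fin m) xs → toℕ b ≤ i → proj i (b ∷ xs) ≢ []
proj-∷-nonempty i b xs b≤i with <-cmp (toℕ b) i
... | tri< _ _ _ = λ ()
... | tri≈ _ _ _ = λ ()
... | tri> _ _ i<b = contradiction i<b (≤⇒≯ b≤i)

heads-separate : ∀ {m} (a b : Fin m) xs ys → toℕ a < toℕ b → proj (toℕ b) (a ∷ xs) ≢ proj (toℕ b) (b ∷ ys)
heads-separate a b xs ys a<b eq = 0≢1+n (∷-injectiveˡ (begin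
  Fin.zero ∷ proj i xs ≡⟨ cong (_++ proj i xs) (symProj-below i a a<b) ⟨
  proj i (a ∷ xs)      ≡⟨ eq ⟩
  proj i (b ∷ ys)      ≡⟨ cong (_++ proj i ys) (symProj-at i b refl) ⟩
  one ∷ proj i ys ∎))
  where
  i : ℕ
  i = toℕ b

≤-top : ∀ {q} (b : Fin (suc (suc q))) → toℕ b ≤ suc (toℕ (fromℕ q))
≤-top {q} b = subst (λ t → toℕ b ≤ suc t) (sym (toℕ-fromℕ q)) (m<1+n⇒m≤n (toℕ<n b))

proj-injective : ∀ {q} (x x′ : List (Fin (suc (suc q)))) →
  (∀ (i : Fin (suc q)) → proj (suc (toℕ i)) x ≡ proj (suc (toℕ i)) x′) → x ≡ x′
proj-injective [] [] same = refl
proj-injective {q} [] (b ∷ x′) same = contradiction (sym (same (fromℕ q))) (proj-∷-nonempty _ b x′ (≤-top b))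
proj-injective {q} (a ∷ x) [] same = contradiction (same (fromℕ q)) (proj-∷-nonempty _ a x (≤-top a))
proj-injective (a ∷ x) (b ∷ x′) same with <-cmp (toℕ a) (toℕ b)
proj-injective (a ∷ x) (Fin.suc b ∷ x′) same | tri< a<b _ _ = contradiction (same b) (heads-separate a (Fin.suc b) x x′ a<b)
proj-injective (Fin.suc a ∷ x) (b ∷ x′) same | tri> _ _ b<a = contradiction (sym (same a)) (heads-separate b (Fin.suc a) x′ x b<a)
proj-injective (a ∷ x) (b ∷ x′) same | tri≈ _ a≡b _ with toℕ-injective {i = a} {j = b} a≡b
... | refl = cong (a ∷_) (proj-injective x x′ (λ i → ++-cancelˡ (symProj (suc (toℕ i)) a) _ _ (same i)))

-- Surjectivity of Φ: fix the levels 1,2,…,m-1 one after the other; each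
-- adjustment keeps the levels already fixed, since they are lower.
Φ-surjective : ∀ {p} (ns : Fin (suc p) → ℕ) (ys : Vec (List (Fin 2)) p) →
  ((i : Fin p) → InImage (suc p) ns (suc (toℕ i)) (lookup ys i)) →
  ∃ λ x → InS (suc p) ns x × tabulate (λ i → proj (suc (toℕ i)) x) ≡ ys
Φ-surjective {p} ns ys ys∈S^ =
  let x , xS , matched = matched-below p ≤-refl
  in x , xS , trans (tabulate-cong (λ i → matched i (toℕ<n i))) (tabulate∘lookup ys)
  where
  matched-below : ∀ k → k ≤ p →
    ∃ λ x → InS (suc p) ns x × (∀ (i : Fin p) → toℕ i < k → proj (suc (toℕ i)) x ≡ lookup ys i)
  matched-below zero _ = canonical ns , canonical-InS ns , λ _ ()
  matched-below (suc k) k<p =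
    let x , xS , matched = matched-below k (<⇒≤ k<p)
        x′ , x′S , at-k , lower = adjust ns (Fin.suc i) x (lookup ys i) xS (image⊆S ns (Fin.suc i) _ (ys∈S^ i))
    in x′ , x′S , extend x x′ matched at-k lower
    where
    i : Fin p
    i = fromℕ< k<p
    extend : ∀ x x′ → (∀ j → toℕ j < k → proj (suc (toℕ j)) x ≡ lookup ys j) →
      proj (suc (toℕ i)) x′ ≡ lookup ys i → (∀ l → l < suc (toℕ i) → proj l x′ ≡ proj l x) →
      ∀ j → toℕ j < suc k → proj (suc (toℕ j)) x′ ≡ lookup ys j
    extend x x′ matched at-k lower j j<1+k with m<1+n⇒m<n∨m≡n j<1+k
    ... | inj₁ j<k = trans (lower _ (s≤s (subst (toℕ j <_) (sym (toℕ-fromℕ< k<p)) j<k))) (matched j j<k)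
    ... | inj₂ j≡k with toℕ-injective {i = j} {j = i} (trans j≡k (sym (toℕ-fromℕ< k<p)))
    ...   | refl = at-k

lemma2 : (p : ℕ) → 1 ≤ p → (n : ℕ) → (ns : Fin (suc p) → ℕ) → total ns ≡ n →
  ((i' : Fin p) → (y : List (Fin 2)) →
    InImage (suc p) ns (suc (toℕ i')) y
      ⇔ InS 2 (pair (prefixSum ns (suc (toℕ i'))) (ns (Fin.suc i'))) y)
  ×
  (((x : List (Fin (suc p))) → InS (suc p) ns x →
      (i' : Fin p) → InImage (suc p) ns (suc (toℕ i')) (proj (suc (toℕ i')) x))
   ×
   ((x x′ : List (Fin (suc p))) → InS (suc p) ns x → InS (suc p) ns x′ →
      tabulate {n = p} (λ i' → proj (suc (toℕ i')) x)
        ≡ tabulate (λ i' → proj (suc (toℕ i')) x′) →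
      x ≡ x′)
   ×
   ((ys : Vec (List (Fin 2)) p) →
      ((i' : Fin p) → InImage (suc p) ns (suc (toℕ i')) (lookup ys i')) →
      ∃ λ x → InS (suc p) ns x × tabulate (λ i' → proj (suc (toℕ i')) x) ≡ ys))
lemma2 zero () _ _ _
lemma2 (suc q) _ _ ns _ =
  (λ i y → image-characterization ns (Fin.suc i) y) ,
  (λ x xS i → x , xS , refl) ,
  (λ x x′ _ _ Φx≡Φx′ → proj-injective x x′ (tabulate-injective Φx≡Φx′)) ,
  Φ-surjective ns
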